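{- Consider an Unbounded Knapsack instance (in particular, a CoinChange instance) with weights $w_1,\dots,w_n\in[1,u]$ and integer profits $p_1,\dots,p_n$. For any lexical order $\sigma$ and any feasible target $j$, $|\mathsf{supp}(\mathsf{sol}(j,\sigma))|\le\log_2(j+1)$.
   Context: A solution to a sum $c$ is $m\in\mathbb{N}^n$ with $\sum_i w_im_i=c$; $c$ is feasible if one exists. Its value is $\sum_i p_im_i$ (for CoinChange, $p_i=-1$ for all $i$), and a solution is optimal if it has maximum value among solutions to the same sum. $\mathsf{supp}(m)=\{i\mid m_i>0\}$. A lexical order $\sigma$ is a permutation of $\{1,\dots,n\}$; solution $A$ is lexicographically smaller than $B$ under $\sigma$ if there is $j$ with $a_{\sigma_k}=b_{\sigma_k}$ for all $k<j$ and $a_{\sigma_j}>b_{\sigma_j}$. $\mathsf{sol}(j,\sigma)$ is the lexicographically smallest (under $\sigma$) optimal solution to $j$. -}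

module Defs where

open import Data.Nat using (ℕ; zero; suc; _+_; _*_; _<_; _>_; _≤_)
open import Data.Integer as ℤ using (ℤ)
open import Data.Fin using (Fin; zero; suc; toℕ)
open import Data.Fin.Permutation using (Permutation′; _⟨$⟩ʳ_)
open import Data.Product using (Σ; _×_)
open import Relation.Binary.PropositionalEquality using (_≡_)
open import Relation.Nullary using (¬_)

Σℕ : ∀ {n} → (Fin n → ℕ) → ℕ
Σℕ {zero}  f = 0
Σℕ {suc n} f = f zero + Σℕ (λ i → f (suc i))

Σℤ : ∀ {n} → (Fin n → ℤ) → ℤ
Σℤ {zero}  f = ℤ.0ℤ
Σℤ {suc n} f = f zero ℤ.+ Σℤ (λ i → f (suc i))

Vector : ℕ → Set
Vector n = Fin n → ℕ

IsSolution : ∀ {n} → (w : Fin n → ℕ) → ℕ → Vector n → Set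
IsSolution w c m = Σℕ (λ i → w i * m i) ≡ c

Feasible : ∀ {n} → (w : Fin n → ℕ) → ℕ → Set
Feasible {n} w c = Σ (Vector n) (IsSolution w c)

value : ∀ {n} → (p : Fin n → ℤ) → Vector n → ℤ
value p m = Σℤ (λ i → p i ℤ.* ℤ.+ m i)

IsOptimal : ∀ {n} → (w : Fin n → ℕ) (p : Fin n → ℤ) → ℕ → Vector n → Set
IsOptimal {n} w p c m =
  IsSolution w c m × (∀ (m' : Vector n) → IsSolution w c m' → value p m' ℤ.≤ value p m)

LexSmaller : ∀ {n} → Permutation′ n → Vector n → Vector n → Set
LexSmaller {n} σ a b =
  Σ (Fin n) λ j →
    (∀ (k : Fin n) → toℕ k < toℕ j → a (σ ⟨$⟩ʳ k) ≡ b (σ ⟨$⟩ʳ k)) ×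
    (a (σ ⟨$⟩ʳ j) > b (σ ⟨$⟩ʳ j))

IsSol : ∀ {n} → (w : Fin n → ℕ) (p : Fin n → ℤ) → ℕ → Permutation′ n → Vector n → Set
IsSol {n} w p c σ m =
  IsOptimal w p c m × (∀ (m' : Vector n) → IsOptimal w p c m' → ¬ LexSmaller σ m' m)

suppSize : ∀ {n} → Vector n → ℕ
suppSize {zero}  m = 0
suppSize {suc n} m with m zero
... | zero  = suppSize (λ i → m (suc i))
... | suc _ = suc (suppSize (λ i → m (suc i)))

-- Let m = sol(j,σ). If two distinct vectors x, y ≤ m had the same weight, then m − x + y
-- and m − y + x would both be solutions; their values add up to twice the optimum, so
-- both are optimal, and one of them is lexicographically smaller than m. Hence the
-- weight is injective on vectors below m, in particular on the 2^|supp m| vectors with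
-- entries in {0,1} on supp m, and all their weights lie in [0, j].
module Submission where

open import Defs
open import Data.Nat using (ℕ; _+_; _^_; _≤_)
open import Data.Integer using (ℤ)
open import Data.Fin using (Fin)
open import Data.Fin.Permutation using (Permutation′)

open import Data.Nat using (zero; suc; _*_; _∸_; _<_; _>_; z≤n; s≤s)
open import Data.Nat.Properties
  using (+-mono-≤; *-monoʳ-≤; *-distribˡ-+; +-assoc; +-comm; +-cancelʳ-≡; +-monoʳ-<;
         ≤-trans; ≤-reflexive; m∸n+n≡m; m+[n∸m]≡n; <-cmp; +-commutativeSemigroup)
import Data.Integer as ℤ
import Data.Integer.Properties as ℤ
open import Data.Fin using (zero; suc; toℕ; fromℕ<; remQuot; combine)
open import Data.Fin.Properties
  using (toℕ-injective; toℕ-fromℕ<; toℕ≤pred[n]; combine-remQuot; injective⇒≤)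
open import Data.Fin.Permutation using (_⟨$⟩ʳ_; _⟨$⟩ˡ_; inverseʳ)
open import Data.Vec.Functional using (zipWith; _∷_; tail)
open import Data.Vec.Functional.Relation.Binary.Pointwise using (Pointwise)
open import Data.Product using (Σ; _×_; _,_; proj₁; proj₂; uncurry)
open import Data.Sum using (_⊎_; inj₁; inj₂; map₁)
open import Data.Empty using (⊥-elim)
open import Function using (_∘_)
open import Relation.Binary.Definitions using (tri<; tri≈; tri>)
open import Relation.Binary.PropositionalEquality
open import Algebra.Properties.CommutativeSemigroup +-commutativeSemigroup
  using (interchange; xy∙z≈xz∙y; x∙yz≈xz∙y)
open import Algebra.Properties.CommutativeSemigroup ℤ.+-commutativeSemigroup
  using () renaming (interchange to ℤ-interchange)

infixl 6 _+ᵛ_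
infix  4 _≤ᵛ_

_+ᵛ_ : ∀ {n} → Vector n → Vector n → Vector n
_+ᵛ_ = zipWith _+_

_≤ᵛ_ : ∀ {n} → Vector n → Vector n → Set
_≤ᵛ_ = Pointwise _≤_

Σℕ-cong : ∀ {n} {f g : Fin n → ℕ} → f ≗ g → Σℕ f ≡ Σℕ g
Σℕ-cong {zero}  f≗g = refl
Σℕ-cong {suc n} f≗g = cong₂ _+_ (f≗g zero) (Σℕ-cong (f≗g ∘ suc))

Σℕ-distrib-+ : ∀ {n} (f g : Fin n → ℕ) → Σℕ (f +ᵛ g) ≡ Σℕ f + Σℕ g
Σℕ-distrib-+ {zero}  f g = refl
Σℕ-distrib-+ {suc n} f g =
  trans (cong (f zero + g zero +_) (Σℕ-distrib-+ (tail f) (tail g)))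
        (interchange (f zero) (g zero) (Σℕ (tail f)) (Σℕ (tail g)))

Σℕ-mono-≤ : ∀ {n} {f g : Fin n → ℕ} → f ≤ᵛ g → Σℕ f ≤ Σℕ g
Σℕ-mono-≤ {zero}  f≤g = z≤n
Σℕ-mono-≤ {suc n} f≤g = +-mono-≤ (f≤g zero) (Σℕ-mono-≤ (f≤g ∘ suc))

Σℤ-cong : ∀ {n} {f g : Fin n → ℤ} → f ≗ g → Σℤ f ≡ Σℤ g
Σℤ-cong {zero}  f≗g = refl
Σℤ-cong {suc n} f≗g = cong₂ ℤ._+_ (f≗g zero) (Σℤ-cong (f≗g ∘ suc))

Σℤ-distrib-+ : ∀ {n} (f g : Fin n → ℤ) →
  Σℤ (zipWith ℤ._+_ f g) ≡ Σℤ f ℤ.+ Σℤ g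
Σℤ-distrib-+ {zero}  f g = refl
Σℤ-distrib-+ {suc n} f g =
  trans (cong (λ t → f zero ℤ.+ g zero ℤ.+ t) (Σℤ-distrib-+ (tail f) (tail g)))
        (ℤ-interchange (f zero) (g zero) (Σℤ (tail f)) (Σℤ (tail g)))

i+j≡k+k∧j≤k⇒k≤i : ∀ {i j k : ℤ} → i ℤ.+ j ≡ k ℤ.+ k → j ℤ.≤ k → k ℤ.≤ i
i+j≡k+k∧j≤k⇒k≤i i+j≡k+k j≤k =
  ℤ.≮⇒≥ (λ i<k → ℤ.<-irrefl i+j≡k+k (ℤ.+-mono-<-≤ i<k j≤k))

module _ {n : ℕ} where

  weight : (Fin n → ℕ) → Vector n → ℕ
  weight w x = Σℕ (λ i → w i * x i)

  weight-cong : ∀ w {x y : Vector n} → x ≗ y → weight w x ≡ weight w y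
  weight-cong w x≗y = Σℕ-cong (λ i → cong (w i *_) (x≗y i))

  weight-distrib-+ : ∀ w (x y : Vector n) → weight w (x +ᵛ y) ≡ weight w x + weight w y
  weight-distrib-+ w x y = trans
    (Σℕ-cong (λ i → *-distribˡ-+ (w i) (x i) (y i)))
    (Σℕ-distrib-+ (λ i → w i * x i) (λ i → w i * y i))

  weight-mono-≤ : ∀ w {x y : Vector n} → x ≤ᵛ y → weight w x ≤ weight w y
  weight-mono-≤ w x≤y = Σℕ-mono-≤ (λ i → *-monoʳ-≤ (w i) (x≤y i))

  value-cong : ∀ p {x y : Vector n} → x ≗ y → value p x ≡ value p y
  value-cong p x≗y = Σℤ-cong (λ i → cong (λ t → p i ℤ.* ℤ.+ t) (x≗y i))

  value-distrib-+ : ∀ p (x y : Vector n) → value p (x +ᵛ y) ≡ value p x ℤ.+ value p y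
  value-distrib-+ p x y = trans
    (Σℤ-cong (λ i → trans (cong (p i ℤ.*_) (ℤ.pos-+ (x i) (y i)))
                          (ℤ.*-distribˡ-+ (p i) _ _)))
    (Σℤ-distrib-+ (λ i → p i ℤ.* ℤ.+ x i) (λ i → p i ℤ.* ℤ.+ y i))

  exchange : Vector n → Vector n → Vector n → Vector n
  exchange m x y i = m i ∸ x i + y i

  module _ {m x : Vector n} (x≤m : x ≤ᵛ m) where

    exchange-+ᵛ : ∀ y → exchange m x y +ᵛ x ≗ m +ᵛ y
    exchange-+ᵛ y i =
      trans (xy∙z≈xz∙y (m i ∸ x i) (y i) (x i)) (cong (_+ y i) (m∸n+n≡m (x≤m i)))

    exchange-+ᵛ-exchange : ∀ {y} → y ≤ᵛ m → exchange m x y +ᵛ exchange m y x ≗ m +ᵛ m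
    exchange-+ᵛ-exchange {y} y≤m i = begin
      exchange m x y i + (m i ∸ y i + x i)  ≡⟨ x∙yz≈xz∙y _ (m i ∸ y i) (x i) ⟩
      exchange m x y i + x i + (m i ∸ y i)  ≡⟨ cong (_+ (m i ∸ y i)) (exchange-+ᵛ y i) ⟩
      m i + y i + (m i ∸ y i)               ≡⟨ +-assoc (m i) (y i) (m i ∸ y i) ⟩
      m i + (y i + (m i ∸ y i))             ≡⟨ cong (m i +_) (m+[n∸m]≡n (y≤m i)) ⟩
      m i + m i                             ∎
      where open ≡-Reasoning

    exchange-≡ : ∀ {y} i → y i ≡ x i → exchange m x y i ≡ m i
    exchange-≡ i yᵢ≡xᵢ = trans (cong (m i ∸ x i +_) yᵢ≡xᵢ) (m∸n+n≡m (x≤m i))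

    exchange-> : ∀ {y} i → y i > x i → exchange m x y i > m i
    exchange-> {y} i yᵢ>xᵢ =
      subst (_< exchange m x y i) (m∸n+n≡m (x≤m i)) (+-monoʳ-< (m i ∸ x i) yᵢ>xᵢ)

  module _ (w : Fin n → ℕ) (p : Fin n → ℤ) {c : ℕ} {m : Vector n} where

    exchange-isSolution : ∀ {x y} → x ≤ᵛ m → IsSolution w c m →
      weight w x ≡ weight w y → IsSolution w c (exchange m x y)
    exchange-isSolution {x} {y} x≤m wm≡c wx≡wy = +-cancelʳ-≡ (weight w x) _ _ (begin
      weight w (exchange m x y) + weight w x  ≡⟨ weight-distrib-+ w (exchange m x y) x ⟨
      weight w (exchange m x y +ᵛ x)          ≡⟨ weight-cong w (exchange-+ᵛ x≤m y) ⟩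
      weight w (m +ᵛ y)                       ≡⟨ weight-distrib-+ w m y ⟩
      weight w m + weight w y                 ≡⟨ cong₂ _+_ wm≡c (sym wx≡wy) ⟩
      c + weight w x                          ∎)
      where open ≡-Reasoning

    exchange-isOptimal : ∀ {x y} → x ≤ᵛ m → y ≤ᵛ m → IsOptimal w p c m →
      weight w x ≡ weight w y → IsOptimal w p c (exchange m x y)
    exchange-isOptimal {x} {y} x≤m y≤m (wm≡c , m-max) wx≡wy =
      exchange-isSolution x≤m wm≡c wx≡wy ,
      λ m′ m′-sol → ℤ.≤-trans (m-max m′ m′-sol) (i+j≡k+k∧j≤k⇒k≤i values-sum other≤m)
      where
      other≤m : value p (exchange m y x) ℤ.≤ value p m
      other≤m = m-max _ (exchange-isSolution y≤m wm≡c (sym wx≡wy))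
      values-sum : value p (exchange m x y) ℤ.+ value p (exchange m y x) ≡
                   value p m ℤ.+ value p m
      values-sum = begin
        value p (exchange m x y) ℤ.+ value p (exchange m y x)
          ≡⟨ value-distrib-+ p _ _ ⟨
        value p (exchange m x y +ᵛ exchange m y x)
          ≡⟨ value-cong p (exchange-+ᵛ-exchange x≤m y≤m) ⟩
        value p (m +ᵛ m)
          ≡⟨ value-distrib-+ p m m ⟩
        value p m ℤ.+ value p m
          ∎
        where open ≡-Reasoning

-- LexSmaller σ a b is FirstExceeds (a ∘ σ) (b ∘ σ).
FirstExceeds : ∀ {n} → (Fin n → ℕ) → (Fin n → ℕ) → Set
FirstExceeds {n} g h =
  Σ (Fin n) λ j → (∀ k → toℕ k < toℕ j → g k ≡ h k) × g j > h j

firstExceeds-suc : ∀ {n} {g h : Fin (suc n) → ℕ} → g zero ≡ h zero →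
  FirstExceeds (tail g) (tail h) → FirstExceeds g h
firstExceeds-suc g₀≡h₀ (j , agree , gⱼ>hⱼ) =
  suc j , (λ { zero _ → g₀≡h₀ ; (suc k) (s≤s k<j) → agree k k<j }) , gⱼ>hⱼ

firstExceeds-trichotomy : ∀ {n} (g h : Fin n → ℕ) →
  g ≗ h ⊎ FirstExceeds g h ⊎ FirstExceeds h g
firstExceeds-trichotomy {zero}  g h = inj₁ λ ()
firstExceeds-trichotomy {suc n} g h with <-cmp (g zero) (h zero)
... | tri< g₀<h₀ _ _ = inj₂ (inj₂ (zero , (λ _ ()) , g₀<h₀))
... | tri> _ _ g₀>h₀ = inj₂ (inj₁ (zero , (λ _ ()) , g₀>h₀))
... | tri≈ _ g₀≡h₀ _ with firstExceeds-trichotomy (tail g) (tail h)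
...   | inj₁ tail≗          = inj₁ λ { zero → g₀≡h₀ ; (suc i) → tail≗ i }
...   | inj₂ (inj₁ g-first) = inj₂ (inj₁ (firstExceeds-suc g₀≡h₀ g-first))
...   | inj₂ (inj₂ h-first) = inj₂ (inj₂ (firstExceeds-suc (sym g₀≡h₀) h-first))

lexSmaller-trichotomy : ∀ {n} (σ : Permutation′ n) (a b : Vector n) →
  a ≗ b ⊎ LexSmaller σ a b ⊎ LexSmaller σ b a
lexSmaller-trichotomy σ a b =
  map₁ (λ a∘σ≗b∘σ i → subst (λ t → a t ≡ b t) (inverseʳ σ) (a∘σ≗b∘σ (σ ⟨$⟩ˡ i)))
       (firstExceeds-trichotomy (λ k → a (σ ⟨$⟩ʳ k)) (λ k → b (σ ⟨$⟩ʳ k)))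

exchange-lexSmaller : ∀ {n} (σ : Permutation′ n) {m x y : Vector n} → x ≤ᵛ m →
  LexSmaller σ y x → LexSmaller σ (exchange m x y) m
exchange-lexSmaller σ {y = y} x≤m (j , agree , y>x) =
  j , (λ k k<j → exchange-≡ x≤m {y} (σ ⟨$⟩ʳ k) (agree k k<j)) ,
  exchange-> x≤m {y} (σ ⟨$⟩ʳ j) y>x

isSol⇒weight-injective : ∀ {n} (w : Fin n → ℕ) (p : Fin n → ℤ) {c : ℕ}
  (σ : Permutation′ n) {m x y : Vector n} → IsSol w p c σ m →
  x ≤ᵛ m → y ≤ᵛ m → weight w x ≡ weight w y → x ≗ y
isSol⇒weight-injective w p σ {x = x} {y} (m-opt , m-least) x≤m y≤m wx≡wy
  with lexSmaller-trichotomy σ x y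
... | inj₁ x≗y = x≗y
... | inj₂ (inj₁ x-first) = ⊥-elim (m-least (exchange _ y x)
        (exchange-isOptimal w p y≤m x≤m m-opt (sym wx≡wy))
        (exchange-lexSmaller σ {y = x} y≤m x-first))
... | inj₂ (inj₂ y-first) = ⊥-elim (m-least (exchange _ x y)
        (exchange-isOptimal w p x≤m y≤m m-opt wx≡wy)
        (exchange-lexSmaller σ {y = y} x≤m y-first))

remQuot-injective : ∀ {m} n {a b : Fin (m * n)} → remQuot n a ≡ remQuot n b → a ≡ b
remQuot-injective {m} n {a} {b} eq = trans (sym (combine-remQuot {m} n a))
  (trans (cong (uncurry (combine {m} {n})) eq) (combine-remQuot {m} n b))

popBit : ∀ k → Fin (2 ^ suc k) → Fin 2 × Fin (2 ^ k)
popBit k = remQuot {2} (2 ^ k)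

-- Each index in supp m consumes one bit of a, which becomes the entry there.
binarySubvector : ∀ {n} (m : Vector n) → Fin (2 ^ suppSize m) → Vector n
binarySubvector {zero}  m a = λ ()
binarySubvector {suc n} m a with m zero
... | zero  = 0 ∷ binarySubvector (tail m) a
... | suc _ = let (bit , rest) = popBit (suppSize (tail m)) a
              in  toℕ bit ∷ binarySubvector (tail m) rest

binarySubvector-≤ᵛ : ∀ {n} (m : Vector n) a → binarySubvector m a ≤ᵛ m
binarySubvector-≤ᵛ {suc n} m a zero with m zero
... | zero  = z≤n
... | suc _ = ≤-trans (toℕ≤pred[n] (proj₁ (popBit (suppSize (tail m)) a))) (s≤s z≤n)
binarySubvector-≤ᵛ {suc n} m a (suc i) with m zero
... | zero  = binarySubvector-≤ᵛ (tail m) a i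
... | suc _ = binarySubvector-≤ᵛ (tail m) (proj₂ (popBit (suppSize (tail m)) a)) i

binarySubvector-injective : ∀ {n} (m : Vector n) {a b} →
  binarySubvector m a ≗ binarySubvector m b → a ≡ b
binarySubvector-injective {zero}  m {zero} {zero} _ = refl
binarySubvector-injective {suc n} m eq with m zero
... | zero  = binarySubvector-injective (tail m) (eq ∘ suc)
... | suc _ = remQuot-injective {2} (2 ^ suppSize (tail m))
  (cong₂ _,_ (toℕ-injective (eq zero)) (binarySubvector-injective (tail m) (eq ∘ suc)))

bounded-injective⇒≤ : ∀ {N c} {f : Fin N → ℕ} → (∀ a → f a ≤ c) →
  (∀ {a b} → f a ≡ f b → a ≡ b) → N ≤ suc c
bounded-injective⇒≤ f≤c f-injective =
  injective⇒≤ {f = λ a → fromℕ< (s≤s (f≤c a))} λ eq →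
    f-injective (trans (sym (toℕ-fromℕ< _)) (trans (cong toℕ eq) (toℕ-fromℕ< _)))

corollary7 : (n u : ℕ) (w : Fin n → ℕ) (p : Fin n → ℤ) →
    (∀ i → 1 ≤ w i) → (∀ i → w i ≤ u) →
    (σ : Permutation′ n) (j : ℕ) → Feasible w j →
    (m : Vector n) → IsSol w p j σ m →
    2 ^ suppSize m ≤ j + 1
corollary7 n u w p _ _ σ j _ m m-sol =
  subst (2 ^ suppSize m ≤_) (+-comm 1 j) (bounded-injective⇒≤ weight≤j weight-injective)
  where
  weight≤j : ∀ a → weight w (binarySubvector m a) ≤ j
  weight≤j a = ≤-trans (weight-mono-≤ w (binarySubvector-≤ᵛ m a))
                       (≤-reflexive (proj₁ (proj₁ m-sol)))
  weight-injective : ∀ {a b} → weight w (binarySubvector m a) ≡ weight w (binarySubvector m b) →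
    a ≡ b
  weight-injective eq = binarySubvector-injective m
    (isSol⇒weight-injective w p σ m-sol (binarySubvector-≤ᵛ m _) (binarySubvector-≤ᵛ m _) eq)
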